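{- There exist a first-order language $\mathcal{L}$, a Kripke $F\!F\!D\!E$-model $\mathcal{K}$ for $\mathcal{L}$, a stage $w$ of $\mathcal{K}$, a formula $A$ with at most $x$ free and a sentence $B$ such that $\mathcal{K},w\vDash\forall x(B\lor A)$ and $\mathcal{K},w\nvDash B\lor\forall xA$.
   Context: Language: connectives $\neg,\land,\lor$, quantifiers $\forall,\exists$, variables, identity $\doteq$ and unary definedness predicate $\mathbf{D}$. A first-order language is $\mathcal{L}=\langle\mathcal{C},\mathcal{P}\rangle$, $\mathcal{C}$ an infinite set of constants, $\mathcal{P}$ a set of predicate letters of finite arities; $\mathcal{P}^{\doteq}=\mathcal{P}\cup\{\doteq\}$; atomic formulas are $Pt_1\dots t_m$, $t_1\doteq t_2$, $\mathbf{D}t$; $c_1\neq c_2$ abbreviates $\neg(c_1\doteq c_2)$; $A(c/x)$ is substitution of $c$ for free $x$. A Kripke $F\!F\!D\!E$-model for $\mathcal{L}$ is $\langle W,\le,d,I,i_+,i_-\rangle$ where: $W\neq\emptyset$; $\le$ is a preorder on $W$; $d$ assigns to each $w$ a set $d(w)$ (possibly empty) with $d(w)\subseteq d(w')$ whenever $w\le w'$; $I$ is a partial function on $(\mathcal{C}\cup\mathcal{P})\times W$ such that if $I(c,w)$ is defined then $I(c,w)\in d(w)$ and $I(c,w')=I(c,w)$ for all $w'\ge w$, and for each $m$-ary $P\in\mathcal{P}$, $I(P,w)=\langle P^w_+,P^w_-\rangle$ with $P^w_+,P^w_-\subseteq d(w)^m$ and $P^w_\pm\subseteq P^{w'}_\pm$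 when $w\le w'$; $i_+(w),i_-(w)$ are binary relations on $d(w)$ such that (a) $i_+(w)$ is an equivalence relation that is a congruence for every $P\in\mathcal{P}$: if $\langle a_j,a'_j\rangle\in i_+(w)$ for all $j\le m$ then $\langle a_1..a_m\rangle\in P^w_+$ iff $\langle a'_1..a'_m\rangle\in P^w_+$, and likewise for $P^w_-$; (b) writing $\doteq^w_+=i_+(w)$, $\doteq^w_-=i_-(w)$, if for some $m$-ary $P\in\mathcal{P}^{\doteq}$ two $m$-tuples differing only in that $a$ occurs in the first where $a'$ occurs in the second (in the same positions) satisfy: the first is in $P^w_+$ and the second in $P^w_-$, then $\langle a,a'\rangle,\langle a',a\rangle\in i_-(w)$; (c) $i_\pm(w)\subseteq i_\pm(w')$ when $w\le w'$. The diagram language $\mathcal{L}_\mathcal{K}=\langle\mathcal{C}\cup\{\bar a: a\in\bigcup_w d(w)\},\mathcal{P}\rangle$ with new constants $\bar a$; $\hat I$ extends $I$ with $\hat I(\bar a,w)=a$ if $a\in d(w)$, undefined otherwise. The valuation $v:Sent(\mathcal{L}_\mathcal{K})\times W\to\{0,1\}$ induced by $\mathcal{K}$ satisfies: $v(\mathbf{D}c,w)=1$ iff $\hat I(c,w)$ defined; $v(\neg\mathbf{D}c,w)=1$ iff $\hat I(c,w)$ undefined; $v(c_1\doteq c_2,w)=1$ iff both $\hat I(c_i,w)$ defined and $\langle\hat I(c_1,w),\hat I(c_2,w)\rangle\in i_+(w)$; $v(c_1\neq c_2,w)=1$ iff both defined and the pair is in $i_-(w)$; for $P\in\mathcal{P}$,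 $v(Pc_1..c_m,w)=1$ iff all $\hat I(c_i,w)$ defined and $\langle\hat I(c_1,w),..,\hat I(c_m,w)\rangle\in P^w_+$, and $v(\neg Pc_1..c_m,w)=1$ iff all defined and the tuple is in $P^w_-$; $v(A\land B)=1$ iff both $1$; $v(A\lor B)=1$ iff one is $1$; $v(\neg(A\land B))=1$ iff $v(\neg A)=1$ or $v(\neg B)=1$; $v(\neg(A\lor B))=1$ iff $v(\neg A)=v(\neg B)=1$; $v(\neg\neg A)=v(A)$ (all at $w$); $v(\forall xA,w)=1$ iff for all $w'\ge w$ and all $a\in d(w')$, $v(A(\bar a/x),w')=1$; $v(\exists xA,w)=1$ iff $v(A(\bar a/x),w)=1$ for some $a\in d(w)$; $v(\neg\forall xA,w)=1$ iff $v(\neg A(\bar a/x),w)=1$ for some $a\in d(w)$; $v(\neg\exists xA,w)=1$ iff for all $w'\ge w$ and all $a\in d(w')$, $v(\neg A(\bar a/x),w')=1$. For a sentence $A$ of $\mathcal{L}_\mathcal{K}$, $\mathcal{K},w\vDash A$ means $v(A,w)=1$. -}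

module Defs where

open import Data.Nat using (ℕ; _≟_)
open import Data.Fin using (Fin; zero; suc)
open import Data.Sum using (_⊎_; inj₁; inj₂)
open import Data.Product using (Σ; ∃; _×_; _,_)
open import Data.Unit using (⊤; tt)
open import Data.Empty using (⊥)
open import Relation.Nullary using (¬_; yes; no)
open import Relation.Binary.PropositionalEquality using (_≡_)

record Language : Set₁ where
  field
    Const     : Set
    embedℕ    : ℕ → Const                -- C is infinite:
    embedℕ-inj : ∀ {m n} → embedℕ m ≡ embedℕ n → m ≡ n
    Pred      : Set
    arity     : Pred → ℕ

-- Syntax, parameterised by the set K of constants in use
-- (K = Const for L itself, K = C ∪ {ā} for the diagram language).
-- Variables are named by natural numbers.

module Syntax (L : Language) where
  open Language L

  data Term (K : Set) : Set where
    var : ℕ → Term K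
    con : K → Term K

  data Formula (K : Set) : Set where
    pred  : (P : Pred) → (Fin (arity P) → Term K) → Formula K
    _≐_   : Term K → Term K → Formula K
    𝐃     : Term K → Formula K
    ¬'    : Formula K → Formula K
    _∧'_  : Formula K → Formula K → Formula K
    _∨'_  : Formula K → Formula K → Formula K
    ∀'    : ℕ → Formula K → Formula K
    ∃'    : ℕ → Formula K → Formula K

  mapT : {K K' : Set} → (K → K') → Term K → Term K'
  mapT f (var x) = var x
  mapT f (con c) = con (f c)

  mapF : {K K' : Set} → (K → K') → Formula K → Formula K'
  mapF f (pred P ts) = pred P (λ j → mapT f (ts j))
  mapF f (t ≐ u)     = mapT f t ≐ mapT f u
  mapF f (𝐃 t)       = 𝐃 (mapT f t)
  mapF f (¬' A)      = ¬' (mapF f A)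
  mapF f (A ∧' B)    = mapF f A ∧' mapF f B
  mapF f (A ∨' B)    = mapF f A ∨' mapF f B
  mapF f (∀' x A)    = ∀' x (mapF f A)
  mapF f (∃' x A)    = ∃' x (mapF f A)

  substT : {K : Set} → Term K → ℕ → K → Term K
  substT (var y) x c with y ≟ x
  ... | yes _ = con c
  ... | no  _ = var y
  substT (con d) x c = con d

  _[_/_] : {K : Set} → Formula K → K → ℕ → Formula K
  pred P ts [ c / x ] = pred P (λ j → substT (ts j) x c)
  (t ≐ u)   [ c / x ] = substT t x c ≐ substT u x c
  𝐃 t       [ c / x ] = 𝐃 (substT t x c)
  ¬' A      [ c / x ] = ¬' (A [ c / x ])
  (A ∧' B)  [ c / x ] = (A [ c / x ]) ∧' (B [ c / x ])
  (A ∨' B)  [ c / x ] = (A [ c / x ]) ∨' (B [ c / x ])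
  ∀' y A    [ c / x ] with y ≟ x
  ... | yes _ = ∀' y A
  ... | no  _ = ∀' y (A [ c / x ])
  ∃' y A    [ c / x ] with y ≟ x
  ... | yes _ = ∃' y A
  ... | no  _ = ∃' y (A [ c / x ])

  data FreeT {K : Set} (y : ℕ) : Term K → Set where
    here : FreeT y (var y)

  data Free {K : Set} (y : ℕ) : Formula K → Set where
    f-pred : ∀ {P ts} j → FreeT y (ts j) → Free y (pred P ts)
    f-≐l   : ∀ {t u} → FreeT y t → Free y (t ≐ u)
    f-≐r   : ∀ {t u} → FreeT y u → Free y (t ≐ u)
    f-𝐃    : ∀ {t} → FreeT y t → Free y (𝐃 t)
    f-¬    : ∀ {A} → Free y A → Free y (¬' A)
    f-∧l   : ∀ {A B} → Free y A → Free y (A ∧' B)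
    f-∧r   : ∀ {A B} → Free y B → Free y (A ∧' B)
    f-∨l   : ∀ {A B} → Free y A → Free y (A ∨' B)
    f-∨r   : ∀ {A B} → Free y B → Free y (A ∨' B)
    f-∀    : ∀ {x A} → ¬ (y ≡ x) → Free y A → Free y (∀' x A)
    f-∃    : ∀ {x A} → ¬ (y ≡ x) → Free y A → Free y (∃' x A)

  Sentence : {K : Set} → Formula K → Set
  Sentence A = ∀ y → ¬ Free y A

  AtMostFree : {K : Set} → ℕ → Formula K → Set
  AtMostFree x A = ∀ y → Free y A → y ≡ x

-- 𝒫^≐ = 𝒫 ∪ {≐}; ≐ is binary and interpreted by ⟨ i₊(w) , i₋(w) ⟩
PredE : Language → Set
PredE L = Language.Pred L ⊎ ⊤

arityE : (L : Language) → PredE L → ℕ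
arityE L (inj₁ P) = Language.arity L P
arityE L (inj₂ _) = 2

extRel : (L : Language) {W Dom : Set} →
         ((P : Language.Pred L) → W → (Fin (Language.arity L P) → Dom) → Set) →
         (W → Dom → Dom → Set) →
         (P : PredE L) → W → (Fin (arityE L P) → Dom) → Set
extRel L R i (inj₁ P) w as = R P w as
extRel L R i (inj₂ _) w as = i w (as zero) (as (suc zero))

record Model (L : Language) : Set₁ where
  open Language L
  field
    W        : Set
    inhabited : W
    _≤_      : W → W → Set
    ≤-refl   : ∀ {w} → w ≤ w
    ≤-trans  : ∀ {u v w} → u ≤ v → v ≤ w → u ≤ w
    Dom      : Set
    d        : W → Dom → Set
    d-mono   : ∀ {w w' a} → w ≤ w' → d w a → d w' a
    -- I on constants: a partial function, given as a functional relation
    Icon       : Const → W → Dom → Set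
    Icon-func  : ∀ {c w a b} → Icon c w a → Icon c w b → a ≡ b
    Icon-dom   : ∀ {c w a} → Icon c w a → d w a
    Icon-mono  : ∀ {c w w' a} → w ≤ w' → Icon c w a → Icon c w' a
    -- I on predicates: extension and anti-extension
    Pos Neg  : (P : Pred) → W → (Fin (arity P) → Dom) → Set
    Pos-dom  : ∀ {P w as} → Pos P w as → ∀ j → d w (as j)
    Neg-dom  : ∀ {P w as} → Neg P w as → ∀ j → d w (as j)
    Pos-mono : ∀ {P w w' as} → w ≤ w' → Pos P w as → Pos P w' as
    Neg-mono : ∀ {P w w' as} → w ≤ w' → Neg P w as → Neg P w' as
    i₊ i₋    : W → Dom → Dom → Set
    i₊-dom   : ∀ {w a b} → i₊ w a b → d w a × d w b
    i₋-dom   : ∀ {w a b} → i₋ w a b → d w a × d w b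
    i₊-refl  : ∀ {w a} → d w a → i₊ w a a
    i₊-sym   : ∀ {w a b} → i₊ w a b → i₊ w b a
    i₊-trans : ∀ {w a b c} → i₊ w a b → i₊ w b c → i₊ w a c
    i₊-cong-Pos : ∀ {P w as bs} → (∀ j → i₊ w (as j) (bs j)) →
                  (Pos P w as → Pos P w bs) × (Pos P w bs → Pos P w as)
    i₊-cong-Neg : ∀ {P w as bs} → (∀ j → i₊ w (as j) (bs j)) →
                  (Neg P w as → Neg P w bs) × (Neg P w bs → Neg P w as)
  field
    -- (b) if two tuples differ only in that a occurs in the first where a'
    -- occurs in the second (at least one such position), the first in P₊
    -- and the second in P₋, then ⟨a,a'⟩ , ⟨a',a⟩ ∈ i₋(w)
    i₋-leibniz : ∀ {w} (P : PredE L) (as bs : Fin (arityE L P) → Dom) (a a' : Dom) →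
                 (∀ j → (as j ≡ bs j) ⊎ (as j ≡ a × bs j ≡ a')) →
                 (∃ λ j → as j ≡ a × bs j ≡ a') →
                 extRel L Pos i₊ P w as → extRel L Neg i₋ P w bs → i₋ w a a' × i₋ w a' a
    i₊-mono  : ∀ {w w' a b} → w ≤ w' → i₊ w a b → i₊ w' a b
    i₋-mono  : ∀ {w w' a b} → w ≤ w' → i₋ w a b → i₋ w' a b

module Semantics (L : Language) (𝒦 : Model L) where
  open Language L
  open Model 𝒦
  open Syntax L

  DiagConst : Set
  DiagConst = Const ⊎ Σ Dom (λ a → ∃ λ w → d w a)

  bar : ∀ {w a} → d w a → DiagConst
  bar {w} {a} da = inj₂ (a , w , da)

  -- Î(t,w) = a   (Î is partial; variables denote nothing)
  Den : Term DiagConst → W → Dom → Set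
  Den (var _)                 w a = ⊥
  Den (con (inj₁ c))          w a = Icon c w a
  Den (con (inj₂ (b , _)))    w a = d w b × b ≡ a

  Defined : Term DiagConst → W → Set
  Defined t w = ∃ λ a → Den t w a

  -- v(A,w) = 1  is  Sat⁺ A w ;   v(¬A,w) = 1  is  Sat⁻ A w
  mutual
    data Sat⁺ : Formula DiagConst → W → Set where
      s-𝐃    : ∀ {t w} → Defined t w → Sat⁺ (𝐃 t) w
      s-≐    : ∀ {t u w a b} → Den t w a → Den u w b → i₊ w a b → Sat⁺ (t ≐ u) w
      s-pred : ∀ {P ts w} (as : Fin (arity P) → Dom) →
               (∀ j → Den (ts j) w (as j)) → Pos P w as → Sat⁺ (pred P ts) w
      s-¬    : ∀ {A w} → Sat⁻ A w → Sat⁺ (¬' A) w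
      s-∧    : ∀ {A B w} → Sat⁺ A w → Sat⁺ B w → Sat⁺ (A ∧' B) w
      s-∨l   : ∀ {A B w} → Sat⁺ A w → Sat⁺ (A ∨' B) w
      s-∨r   : ∀ {A B w} → Sat⁺ B w → Sat⁺ (A ∨' B) w
      s-∀    : ∀ {x A w} →
               (∀ w' → w ≤ w' → ∀ a → (da : d w' a) → Sat⁺ (A [ bar da / x ]) w') →
               Sat⁺ (∀' x A) w
      s-∃    : ∀ {x A w} a → (da : d w a) → Sat⁺ (A [ bar da / x ]) w →
               Sat⁺ (∃' x A) w

    data Sat⁻ : Formula DiagConst → W → Set where
      s-𝐃    : ∀ {t w} → ¬ Defined t w → Sat⁻ (𝐃 t) w
      s-≐    : ∀ {t u w a b} → Den t w a → Den u w b → i₋ w a b → Sat⁻ (t ≐ u) w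
      s-pred : ∀ {P ts w} (as : Fin (arity P) → Dom) →
               (∀ j → Den (ts j) w (as j)) → Neg P w as → Sat⁻ (pred P ts) w
      s-¬    : ∀ {A w} → Sat⁺ A w → Sat⁻ (¬' A) w
      s-∧l   : ∀ {A B w} → Sat⁻ A w → Sat⁻ (A ∧' B) w
      s-∧r   : ∀ {A B w} → Sat⁻ B w → Sat⁻ (A ∧' B) w
      s-∨    : ∀ {A B w} → Sat⁻ A w → Sat⁻ B w → Sat⁻ (A ∨' B) w
      s-∀    : ∀ {x A w} a → (da : d w a) → Sat⁻ (A [ bar da / x ]) w →
               Sat⁻ (∀' x A) w
      s-∃    : ∀ {x A w} →
               (∀ w' → w ≤ w' → ∀ a → (da : d w' a) → Sat⁻ (A [ bar da / x ]) w') →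
               Sat⁻ (∃' x A) w

  _⊨_ : W → Formula DiagConst → Set
  w ⊨ A = Sat⁺ A w

  ⌜_⌝ : Formula Const → Formula DiagConst
  ⌜ A ⌝ = mapF inj₁ A

{-# OPTIONS --safe #-}
module Submission where

open import Defs
open import Data.Nat using (ℕ)
open import Data.Fin using (Fin; zero)
open import Data.Product using (Σ; _×_; _,_; proj₂)
open import Data.Sum using (inj₁; inj₂)
open import Data.Unit using (⊤; tt)
open import Data.Empty using (⊥)
open import Relation.Nullary using (¬_)
open import Relation.Binary.PropositionalEquality using (_≡_; refl; sym; trans; subst)

-- Kripke quantification ranges over all later stages, so ∀x(B ∨ A) may hold
-- at w₀ because B becomes true exactly at the stage w₁ where a new individual
-- falsifying A appears.  At w₀ itself B is still false, and ∀x A fails there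
-- because of that future counterexample.  Concretely: B = 𝐃c, where c only
-- acquires a denotation at w₁, and A = P x, where P holds of the old
-- individual only.

language : Language
language = record
  { Const = ℕ ; embedℕ = λ n → n ; embedℕ-inj = λ e → e
  ; Pred = ⊤ ; arity = λ _ → 1
  }

data Stage : Set where
  w₀ w₁ : Stage

data _≼_ : Stage → Stage → Set where
  ≼-refl : ∀ {w} → w ≼ w
  w₀≼w₁  : w₀ ≼ w₁

≼-trans : ∀ {u v w} → u ≼ v → v ≼ w → u ≼ w
≼-trans ≼-refl v≼w = v≼w
≼-trans w₀≼w₁  ≼-refl = w₀≼w₁

data Individual : Set where
  old new : Individual

data Exists : Stage → Individual → Set where
  old-exists : ∀ {w} → Exists w old
  new-exists : Exists w₁ new

Exists-mono : ∀ {w w' a} → w ≼ w' → Exists w a → Exists w' a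
Exists-mono ≼-refl a∈w  = a∈w
Exists-mono w₀≼w₁  old-exists = old-exists

data Denotes : ℕ → Stage → Individual → Set where
  denotes-old : ∀ {c} → Denotes c w₁ old

IsOld : ⊤ → Stage → (Fin 1 → Individual) → Set
IsOld _ _ as = as zero ≡ old

Same : Stage → Individual → Individual → Set
Same w a b = Exists w a × a ≡ b

countermodel : Model language
countermodel = record
  { W = Stage ; inhabited = w₀ ; _≤_ = _≼_ ; ≤-refl = ≼-refl ; ≤-trans = ≼-trans
  ; Dom = Individual ; d = Exists ; d-mono = Exists-mono
  ; Icon = Denotes
  ; Icon-func = λ { denotes-old denotes-old → refl }
  ; Icon-dom = λ { denotes-old → old-exists }
  ; Icon-mono = λ { ≼-refl c↦a → c↦a ; w₀≼w₁ () }
  ; Pos = IsOld ; Neg = λ _ _ _ → ⊥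
  ; Pos-dom = λ { as₀≡old zero → subst (Exists _) (sym as₀≡old) old-exists }
  ; Neg-dom = λ ()
  ; Pos-mono = λ _ p → p
  ; Neg-mono = λ _ p → p
  ; i₊ = Same ; i₋ = λ _ _ _ → ⊥
  ; i₊-dom = λ { (a∈w , refl) → a∈w , a∈w }
  ; i₊-refl = λ a∈w → a∈w , refl
  ; i₊-sym = λ { (a∈w , refl) → a∈w , refl }
  ; i₊-trans = λ { (a∈w , refl) (_ , refl) → a∈w , refl }
  ; i₋-dom = λ ()
  ; i₊-cong-Pos = λ as≈bs → let e = proj₂ (as≈bs zero) in trans (sym e) , trans e
  ; i₊-cong-Neg = λ _ → (λ ()) , (λ ())
  ; i₋-leibniz = λ { (inj₁ _) _ _ _ _ _ _ _ () ; (inj₂ _) _ _ _ _ _ _ _ () }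
  ; i₊-mono = λ { w≼w' (a∈w , e) → Exists-mono w≼w' a∈w , e }
  ; i₋-mono = λ _ ()
  }

open Syntax language
open Semantics language countermodel

x : ℕ
x = 0

Px : Formula ℕ
Px = pred tt (λ _ → var x)

Dc : Formula ℕ
Dc = 𝐃 (con 0)

Px-AtMostFree : AtMostFree x Px
Px-AtMostFree _ (f-pred zero here) = refl

Dc-Sentence : Sentence Dc
Dc-Sentence _ (f-𝐃 ())

Dc-false-at-w₀ : ¬ (w₀ ⊨ ⌜ Dc ⌝)
Dc-false-at-w₀ (s-𝐃 (_ , ()))

Dc-true-at-w₁ : w₁ ⊨ ⌜ Dc ⌝
Dc-true-at-w₁ = s-𝐃 (old , denotes-old)

P-old : ∀ {w} (old∈w : Exists w old) → w ⊨ (⌜ Px ⌝ [ bar old∈w / x ])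
P-old old∈w = s-pred (λ _ → old) (λ { zero → old∈w , refl }) refl

¬P-new : ¬ (w₁ ⊨ (⌜ Px ⌝ [ bar new-exists / x ]))
¬P-new (s-pred as den as₀≡old) with trans (proj₂ (den zero)) as₀≡old
... | ()

Dc∨Px-everywhere : ∀ w a (a∈w : Exists w a) → w ⊨ (⌜ Dc ∨' Px ⌝ [ bar a∈w / x ])
Dc∨Px-everywhere _  old old-exists = s-∨r (P-old old-exists)
Dc∨Px-everywhere w₁ new new-exists = s-∨l Dc-true-at-w₁

proposition10 : Σ Language λ L → Σ (Model L) λ 𝒦 → Σ (Model.W 𝒦) λ w →
    Σ ℕ λ x → Σ (Syntax.Formula L (Language.Const L)) λ A → Σ (Syntax.Formula L (Language.Const L)) λ B →
      Syntax.AtMostFree L x A × Syntax.Sentence L B ×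
      Semantics._⊨_ L 𝒦 w (Semantics.⌜_⌝ L 𝒦 (Syntax.∀' x (Syntax._∨'_ B A))) ×
      ¬ Semantics._⊨_ L 𝒦 w (Semantics.⌜_⌝ L 𝒦 (Syntax._∨'_ B (Syntax.∀' x A)))
proposition10 =
  language , countermodel , w₀ , x , Px , Dc , Px-AtMostFree , Dc-Sentence ,
  s-∀ (λ w _ → Dc∨Px-everywhere w) , Dc∨∀Px-false-at-w₀
  where
  Dc∨∀Px-false-at-w₀ : ¬ (w₀ ⊨ ⌜ Dc ∨' ∀' x Px ⌝)
  Dc∨∀Px-false-at-w₀ (s-∨l Dc-at-w₀)   = Dc-false-at-w₀ Dc-at-w₀
  Dc∨∀Px-false-at-w₀ (s-∨r (s-∀ ∀Px)) = ¬P-new (∀Px w₁ w₀≼w₁ new new-exists)
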